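{- Let $m,n$ be positive integers and let $B_{m,n}$ be the set of words $w=w_1\cdots w_{(m+1)n}\in\{0,1\}^{(m+1)n}$ containing exactly $n$ zeros and $mn$ ones, with $w_1=0$, and with $\sum_{i:\,w_i=1} i\equiv -1 \pmod n$. Then every $w\in B_{m,n}$ is primitive, i.e. for $k=(m+1)n$ and every $1\le j\le k-1$, the cyclic rotation $w_{j+1}\cdots w_k w_1\cdots w_j$ is different from $w$. -}

module Defs where

open import Data.Nat using (ℕ; zero; suc; _+_; _*_; _<_; _≤_; NonZero)
open import Data.Nat.DivMod using (_%_; m%n<n)
open import Data.Nat.Divisibility using (_∣_)
open import Data.Bool using (Bool; true; false)
open import Data.Fin using (Fin; toℕ; fromℕ<)
open import Data.List using (List; length; filter; map)
open import Data.Nat.ListAction using (sum)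
open import Data.Fin using () renaming (zero to fzero)
open import Data.Vec.Functional using (Vector; toList)
open import Relation.Binary.PropositionalEquality using (_≡_)
open import Relation.Nullary using (¬_)
open import Data.Product using (_×_)
import Data.Bool as B

-- A binary word of length k: position i (0-indexed as Fin k, i.e. position toℕ i + 1
-- in the paper's 1-indexed convention).  true = letter 1, false = letter 0.
Word : ℕ → Set
Word k = Fin k → Bool

count : {k : ℕ} → Bool → Word k → ℕ
count {k} b w = length (filter (λ i → b B.≟ w i) (toList (λ (i : Fin k) → i)))

onesPosSum : {k : ℕ} → Word k → ℕ
onesPosSum {k} w = sum (map (λ i → suc (toℕ i)) (filter (λ i → true B.≟ w i) (toList (λ (i : Fin k) → i))))

-- membership in B_{m,n}; words of length (m+1)n.
-- the sum condition  Σ ≡ -1 (mod n)  is written  n ∣ Σ + 1.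
InB : (m n : ℕ) → Word ((m + 1) * n) → Set
InB m n w =
  (count false w ≡ n) × (count true w ≡ m * n) ×
  ((p : 0 < (m + 1) * n) → w (fromℕ< p) ≡ false) × (n ∣ onesPosSum w + 1)

-- cyclic rotation by j: (rotate j w)_i = w_{(i + j) mod k}, i.e. w_{j+1} ⋯ w_k w_1 ⋯ w_j
rotate : {k : ℕ} .{{_ : NonZero k}} → ℕ → Word k → Word k
rotate {k} j w i = w (fromℕ< (m%n<n (toℕ i + j) k))

_≋_ : {k : ℕ} → Word k → Word k → Set
u ≋ v = ∀ i → u i ≡ v i

-- If rotating w by j fixes it, the periodic extension of w has periods j and k = (m+1)n, hence
-- period d = gcd j k, and w = uᵗ for a block u of length d, with t = k/d.  Counting block by
-- block, n = t·z and mn = t·o for the numbers z, o of zeros and ones in u, so d = (m+1)z and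
-- o = mz.  The positions of the ones sum to t·P + (t(t−1)/2)·d·o, where P is the sum inside u,
-- and d·o = m(m+1)z² is even, so t divides that sum.  Since t ∣ n ∣ sum + 1, t = 1, i.e.
-- d = k > j, contradicting d ∣ j.

module Submission where

open import Defs
open import Data.Nat using (ℕ; zero; suc; _+_; _*_; _≤_; _<_; NonZero; s≤s; z≤n; ≢-nonZero⁻¹)
open import Data.Nat.Properties hiding (_≟_)
open import Algebra.Properties.CommutativeSemigroup +-commutativeSemigroup
  using () renaming (interchange to +-interchange; x∙yz≈xz∙y to m+[n+o]≡m+o+n)
open import Algebra.Properties.CommutativeSemigroup *-commutativeSemigroup
  using () renaming (x∙yz≈y∙xz to m*[n*o]≡n*[m*o])
open import Data.Nat.DivMod using (_%_; m%n<n; m%n%n≡m%n; %-distribˡ-+; [m+n]%n≡m%n; m<n⇒m%n≡m)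
open import Data.Nat.Divisibility
open import Data.Nat.GCD using (gcd; gcd-GCD; gcd[m,n]∣m; gcd[m,n]∣n; module Bézout)
open import Data.Nat.ListAction using (sum)
open import Data.Nat.Tactic.RingSolver using (solve-∀)
open import Data.Bool using (Bool; true; false; _≟_)
open import Data.Fin using (Fin; toℕ; fromℕ<)
open import Data.Fin.Properties using (toℕ-fromℕ<; toℕ-injective; toℕ<n)
open import Data.List using (length; filter; map; tabulate)
open import Data.List.Properties using (tabulate-cong)
open import Data.Product using (_,_)
open import Function using (_∘_)
open import Relation.Binary.PropositionalEquality
open import Relation.Nullary using (Dec; yes; no; ¬_; contradiction)
open import Relation.Unary using (Pred; Decidable)

∑ : ℕ → (ℕ → ℕ) → ℕ
∑ zero    f = 0
∑ (suc n) f = f 0 + ∑ n (f ∘ suc)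

syntax ∑ n (λ i → e) = ∑[ i < n ] e

∑-cong : ∀ n {f g : ℕ → ℕ} → (∀ i → i < n → f i ≡ g i) → ∑ n f ≡ ∑ n g
∑-cong zero    f≗g = refl
∑-cong (suc n) f≗g = cong₂ _+_ (f≗g 0 (s≤s z≤n)) (∑-cong n (λ i i<n → f≗g (suc i) (s≤s i<n)))

∑-distrib-+ : ∀ n (f g : ℕ → ℕ) → ∑[ i < n ] (f i + g i) ≡ ∑ n f + ∑ n g
∑-distrib-+ zero    f g = refl
∑-distrib-+ (suc n) f g = trans (cong (f 0 + g 0 +_) (∑-distrib-+ n (f ∘ suc) (g ∘ suc)))
                                (+-interchange (f 0) (g 0) _ _)

∑-*ˡ : ∀ n c (f : ℕ → ℕ) → ∑[ i < n ] (c * f i) ≡ c * ∑ n f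
∑-*ˡ zero    c f = sym (*-zeroʳ c)
∑-*ˡ (suc n) c f = trans (cong (c * f 0 +_) (∑-*ˡ n c (f ∘ suc))) (sym (*-distribˡ-+ c (f 0) _))

∑-*ʳ : ∀ n c (f : ℕ → ℕ) → ∑[ i < n ] (f i * c) ≡ ∑ n f * c
∑-*ʳ zero    c f = refl
∑-*ʳ (suc n) c f = trans (cong (f 0 * c +_) (∑-*ʳ n c (f ∘ suc))) (sym (*-distribʳ-+ c (f 0) _))

∑-const : ∀ n c → ∑[ i < n ] c ≡ n * c
∑-const zero    c = refl
∑-const (suc n) c = cong (c +_) (∑-const n c)

∑-snoc : ∀ n (f : ℕ → ℕ) → ∑ (suc n) f ≡ ∑ n f + f n
∑-snoc zero    f = +-comm (f 0) 0
∑-snoc (suc n) f = trans (cong (f 0 +_) (∑-snoc n (f ∘ suc))) (sym (+-assoc (f 0) _ _))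

∑-split : ∀ a b (f : ℕ → ℕ) → ∑ (a + b) f ≡ ∑ a f + ∑[ i < b ] f (a + i)
∑-split zero    b f = refl
∑-split (suc a) b f = trans (cong (f 0 +_) (∑-split a b (f ∘ suc))) (sym (+-assoc (f 0) _ _))

∑-blocks : ∀ t d (f : ℕ → ℕ) → ∑ (t * d) f ≡ ∑[ s < t ] ∑[ r < d ] f (s * d + r)
∑-blocks zero    d f = refl
∑-blocks (suc t) d f = begin
  ∑ (d + t * d) f                                    ≡⟨ ∑-split d (t * d) f ⟩
  ∑ d f + ∑[ i < t * d ] f (d + i)                   ≡⟨ cong (∑ d f +_) (∑-blocks t d (λ i → f (d + i))) ⟩
  ∑ d f + ∑[ s < t ] ∑[ r < d ] f (d + (s * d + r))  ≡⟨ cong (∑ d f +_) (∑-cong t (λ s _ → ∑-cong d (λ r _ → reassoc s r))) ⟩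
  ∑ d f + ∑[ s < t ] ∑[ r < d ] f (d + s * d + r)    ∎
  where
  open ≡-Reasoning
  reassoc : ∀ s r → f (d + (s * d + r)) ≡ f (d + s * d + r)
  reassoc s r = cong f (sym (+-assoc d (s * d) r))

triangle : ℕ → ℕ
triangle n = ∑[ i < n ] i

2*triangle[1+n]≡[1+n]*n : ∀ n → 2 * triangle (suc n) ≡ suc n * n
2*triangle[1+n]≡[1+n]*n zero    = refl
2*triangle[1+n]≡[1+n]*n (suc n) = begin
  2 * triangle (suc (suc n))        ≡⟨ cong (2 *_) (∑-snoc (suc n) (λ i → i)) ⟩
  2 * (triangle (suc n) + suc n)    ≡⟨ *-distribˡ-+ 2 (triangle (suc n)) (suc n) ⟩
  2 * triangle (suc n) + 2 * suc n  ≡⟨ cong (_+ 2 * suc n) (2*triangle[1+n]≡[1+n]*n n) ⟩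
  suc n * n + 2 * suc n             ≡⟨ step n ⟩
  suc (suc n) * suc n               ∎
  where
  open ≡-Reasoning
  step : ∀ n → suc n * n + 2 * suc n ≡ suc (suc n) * suc n
  step = solve-∀

n∣triangle[n]*[a*[1+a]] : ∀ n a → n ∣ triangle n * (a * suc a)
n∣triangle[n]*[a*[1+a]] zero    a = 0 ∣0
n∣triangle[n]*[a*[1+a]] (suc n) a = divides (n * triangle (suc a)) (begin
  triangle (suc n) * (a * suc a)            ≡⟨ cong (triangle (suc n) *_) a*[1+a]≡2*triangle[1+a] ⟩
  triangle (suc n) * (2 * triangle (suc a)) ≡⟨ regroup (triangle (suc n)) (triangle (suc a)) ⟩
  2 * triangle (suc n) * triangle (suc a)   ≡⟨ cong (_* triangle (suc a)) (2*triangle[1+n]≡[1+n]*n n) ⟩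
  suc n * n * triangle (suc a)              ≡⟨ regroup′ (suc n) n (triangle (suc a)) ⟩
  n * triangle (suc a) * suc n              ∎)
  where
  open ≡-Reasoning
  a*[1+a]≡2*triangle[1+a] : a * suc a ≡ 2 * triangle (suc a)
  a*[1+a]≡2*triangle[1+a] = sym (trans (2*triangle[1+n]≡[1+n]*n a) (*-comm (suc a) a))
  regroup : ∀ x y → x * (2 * y) ≡ 2 * x * y
  regroup = solve-∀
  regroup′ : ∀ x y z → x * y * z ≡ y * z * x
  regroup′ = solve-∀

𝟙 : ∀ {p} {P : Set p} → Dec P → ℕ
𝟙 (yes _) = 1
𝟙 (no _)  = 0

module _ {a p} {A : Set a} {P : Pred A p} (P? : Decidable P) where

  length-filter-tabulate : ∀ n (h : ℕ → A) →
    length (filter P? (tabulate {n = n} (h ∘ toℕ))) ≡ ∑[ i < n ] 𝟙 (P? (h i))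
  length-filter-tabulate zero    h = refl
  length-filter-tabulate (suc n) h with P? (h 0)
  ... | yes _ = cong suc (length-filter-tabulate n (h ∘ suc))
  ... | no _  = length-filter-tabulate n (h ∘ suc)

  sum-map-filter-tabulate : ∀ n (φ : A → ℕ) (h : ℕ → A) →
    sum (map φ (filter P? (tabulate {n = n} (h ∘ toℕ)))) ≡ ∑[ i < n ] (𝟙 (P? (h i)) * φ (h i))
  sum-map-filter-tabulate zero    φ h = refl
  sum-map-filter-tabulate (suc n) φ h with P? (h 0)
  ... | yes _ = cong₂ _+_ (sym (*-identityˡ (φ (h 0)))) (sum-map-filter-tabulate n φ (h ∘ suc))
  ... | no _  = sum-map-filter-tabulate n φ (h ∘ suc)

module _ {a} {A : Set a} where

  Period : (ℕ → A) → ℕ → Set a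
  Period f p = ∀ i → f (i + p) ≡ f i

  period-* : ∀ {f p} → Period f p → ∀ q → Period f (q * p)
  period-* {f} per zero    i = cong f (+-identityʳ i)
  period-* {f} {p} per (suc q) i = begin
    f (i + (p + q * p))  ≡⟨ cong f (m+[n+o]≡m+o+n i p (q * p)) ⟩
    f (i + q * p + p)    ≡⟨ per (i + q * p) ⟩
    f (i + q * p)        ≡⟨ period-* per q i ⟩
    f i                  ∎
    where open ≡-Reasoning

  period-gcd : ∀ {f a b} → Period f a → Period f b → Period f (gcd a b)
  period-gcd {f} {a} {b} per-a per-b i with Bézout.identity (gcd-GCD a b)
  ... | Bézout.+- x y d+yb≡xa = begin
    f (i + gcd a b)            ≡⟨ period-* per-b y (i + gcd a b) ⟨
    f (i + gcd a b + y * b)    ≡⟨ cong f (trans (+-assoc i _ _) (cong (i +_) d+yb≡xa)) ⟩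
    f (i + x * a)              ≡⟨ period-* per-a x i ⟩
    f i                        ∎
    where open ≡-Reasoning
  ... | Bézout.-+ x y d+xa≡yb = begin
    f (i + gcd a b)            ≡⟨ period-* per-a x (i + gcd a b) ⟨
    f (i + gcd a b + x * a)    ≡⟨ cong f (trans (+-assoc i _ _) (cong (i +_) d+xa≡yb)) ⟩
    f (i + y * b)              ≡⟨ period-* per-b y i ⟩
    f i                        ∎
    where open ≡-Reasoning

  period-offset : ∀ {f p} → Period f p → ∀ s r → f (s * p + r) ≡ f r
  period-offset {f} {p} per s r = trans (cong f (+-comm (s * p) r)) (period-* per s r)

module _ {f : ℕ → ℕ} {d : ℕ} (per : Period f d) where

  ∑-periodic : ∀ t → ∑ (t * d) f ≡ t * ∑ d f
  ∑-periodic t = begin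
    ∑ (t * d) f                            ≡⟨ ∑-blocks t d f ⟩
    ∑[ s < t ] ∑[ r < d ] f (s * d + r)    ≡⟨ ∑-cong t (λ s _ → ∑-cong d (λ r _ → period-offset per s r)) ⟩
    ∑[ s < t ] ∑ d f                       ≡⟨ ∑-const t (∑ d f) ⟩
    t * ∑ d f                              ∎
    where open ≡-Reasoning

  ∑-periodic-weighted : ∀ t → ∑[ i < t * d ] (f i * suc i)
                            ≡ t * ∑[ r < d ] (f r * suc r) + triangle t * (d * ∑ d f)
  ∑-periodic-weighted t = begin
    ∑[ i < t * d ] (f i * suc i)                                        ≡⟨ ∑-blocks t d _ ⟩
    ∑[ s < t ] ∑[ r < d ] (f (s * d + r) * suc (s * d + r))             ≡⟨ ∑-cong t (λ s _ → block s) ⟩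
    ∑[ s < t ] (∑[ r < d ] (f r * suc r) + s * (d * ∑ d f))             ≡⟨ ∑-distrib-+ t _ _ ⟩
    ∑[ s < t ] ∑[ r < d ] (f r * suc r) + ∑[ s < t ] (s * (d * ∑ d f))  ≡⟨ cong₂ _+_ (∑-const t _) (∑-*ʳ t _ (λ s → s)) ⟩
    t * ∑[ r < d ] (f r * suc r) + triangle t * (d * ∑ d f)             ∎
    where
    open ≡-Reasoning
    shift : ∀ e s p r → e * suc (s * p + r) ≡ e * suc r + s * (p * e)
    shift = solve-∀
    term : ∀ s r → f (s * d + r) * suc (s * d + r) ≡ f r * suc r + s * (d * f r)
    term s r = trans (cong (_* suc (s * d + r)) (period-offset per s r)) (shift (f r) s d r)
    block : ∀ s → ∑[ r < d ] (f (s * d + r) * suc (s * d + r)) ≡ ∑[ r < d ] (f r * suc r) + s * (d * ∑ d f)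
    block s = begin
      ∑[ r < d ] (f (s * d + r) * suc (s * d + r))          ≡⟨ ∑-cong d (λ r _ → term s r) ⟩
      ∑[ r < d ] (f r * suc r + s * (d * f r))              ≡⟨ ∑-distrib-+ d _ _ ⟩
      ∑[ r < d ] (f r * suc r) + ∑[ r < d ] (s * (d * f r)) ≡⟨ cong (_ +_) (trans (∑-*ˡ d s _) (cong (s *_) (∑-*ˡ d d f))) ⟩
      ∑[ r < d ] (f r * suc r) + s * (d * ∑ d f)            ∎

module _ {k : ℕ} .{{_ : NonZero k}} where

  cyclicIndex : ℕ → Fin k
  cyclicIndex i = fromℕ< (m%n<n i k)

  toℕ-cyclicIndex : ∀ i → toℕ (cyclicIndex i) ≡ i % k
  toℕ-cyclicIndex i = toℕ-fromℕ< (m%n<n i k)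

  cyclicIndex-cong-% : ∀ {i i′} → i % k ≡ i′ % k → cyclicIndex i ≡ cyclicIndex i′
  cyclicIndex-cong-% {i} {i′} eq =
    toℕ-injective (trans (toℕ-cyclicIndex i) (trans eq (sym (toℕ-cyclicIndex i′))))

  toℕ-cyclicIndex-< : ∀ {i} → i < k → toℕ (cyclicIndex i) ≡ i
  toℕ-cyclicIndex-< {i} i<k = trans (toℕ-cyclicIndex i) (m<n⇒m%n≡m i<k)

  cyclicIndex-toℕ : ∀ (i : Fin k) → cyclicIndex (toℕ i) ≡ i
  cyclicIndex-toℕ i = toℕ-injective (toℕ-cyclicIndex-< (toℕ<n i))

  extend : Word k → ℕ → Bool
  extend w = w ∘ cyclicIndex

  extend-period : (w : Word k) → Period (extend w) k
  extend-period w i = cong w (cyclicIndex-cong-% ([m+n]%n≡m%n i k))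

  rotate-fixed⇒period : ∀ {w : Word k} j → rotate j w ≋ w → Period (extend w) j
  rotate-fixed⇒period {w} j fixed i = begin
    w (cyclicIndex (i + j))                          ≡⟨ cong w (cyclicIndex-cong-% i%k+j≡i+j) ⟩
    w (cyclicIndex (toℕ (cyclicIndex i) + j))        ≡⟨ fixed (cyclicIndex i) ⟩
    w (cyclicIndex i)                                ∎
    where
    open ≡-Reasoning
    i%k+j≡i+j : (i + j) % k ≡ (toℕ (cyclicIndex i) + j) % k
    i%k+j≡i+j rewrite toℕ-cyclicIndex i = begin
      (i + j) % k                 ≡⟨ %-distribˡ-+ i j k ⟩
      (i % k + j % k) % k         ≡⟨ cong (λ x → (x + j % k) % k) (m%n%n≡m%n i k) ⟨
      (i % k % k + j % k) % k     ≡⟨ %-distribˡ-+ (i % k) j k ⟨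
      (i % k + j) % k             ∎

  tabulate-id≡tabulate-cyclicIndex : tabulate {n = k} (λ i → i) ≡ tabulate (cyclicIndex ∘ toℕ)
  tabulate-id≡tabulate-cyclicIndex = tabulate-cong (λ i → sym (cyclicIndex-toℕ i))

  count≡∑ : ∀ b (w : Word k) → count b w ≡ ∑[ i < k ] 𝟙 (b ≟ extend w i)
  count≡∑ b w = trans (cong (length ∘ filter _) tabulate-id≡tabulate-cyclicIndex)
                      (length-filter-tabulate (λ i → b ≟ w i) k cyclicIndex)

  onesPosSum≡∑ : ∀ (w : Word k) → onesPosSum w ≡ ∑[ i < k ] (𝟙 (true ≟ extend w i) * suc i)
  onesPosSum≡∑ w = begin
    onesPosSum w
      ≡⟨ cong (sum ∘ map (suc ∘ toℕ) ∘ filter _) tabulate-id≡tabulate-cyclicIndex ⟩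
    sum (map (suc ∘ toℕ) (filter (λ i → true ≟ w i) (tabulate {n = k} (cyclicIndex ∘ toℕ))))
      ≡⟨ sum-map-filter-tabulate (λ i → true ≟ w i) k (suc ∘ toℕ) cyclicIndex ⟩
    ∑[ i < k ] (𝟙 (true ≟ extend w i) * suc (toℕ (cyclicIndex i)))
      ≡⟨ ∑-cong k (λ i i<k → cong (λ x → 𝟙 (true ≟ extend w i) * suc x) (toℕ-cyclicIndex-< i<k)) ⟩
    ∑[ i < k ] (𝟙 (true ≟ extend w i) * suc i)
      ∎
    where open ≡-Reasoning

module PowerOfBlock {k : ℕ} .{{_ : NonZero k}} (w : Word k) {d t : ℕ}
                    (per : Period (extend w) d) (k≡t*d : k ≡ t * d) where

  open ≡-Reasoning

  countInBlock : Bool → ℕ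
  countInBlock b = ∑[ r < d ] 𝟙 (b ≟ extend w r)

  onesPosSumInBlock : ℕ
  onesPosSumInBlock = ∑[ r < d ] (𝟙 (true ≟ extend w r) * suc r)

  count-power : ∀ b → count b w ≡ t * countInBlock b
  count-power b = begin
    count b w                         ≡⟨ count≡∑ b w ⟩
    ∑[ i < k ] 𝟙 (b ≟ extend w i)     ≡⟨ cong (λ l → ∑[ i < l ] 𝟙 (b ≟ extend w i)) k≡t*d ⟩
    ∑[ i < t * d ] 𝟙 (b ≟ extend w i) ≡⟨ ∑-periodic (λ i → cong (λ c → 𝟙 (b ≟ c)) (per i)) t ⟩
    t * countInBlock b                ∎

  onesPosSum-power : onesPosSum w ≡ t * onesPosSumInBlock + triangle t * (d * countInBlock true)
  onesPosSum-power = begin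
    onesPosSum w                                         ≡⟨ onesPosSum≡∑ w ⟩
    ∑[ i < k ] (𝟙 (true ≟ extend w i) * suc i)           ≡⟨ cong (λ l → ∑[ i < l ] (𝟙 (true ≟ extend w i) * suc i)) k≡t*d ⟩
    ∑[ i < t * d ] (𝟙 (true ≟ extend w i) * suc i)       ≡⟨ ∑-periodic-weighted (λ i → cong (λ c → 𝟙 (true ≟ c)) (per i)) t ⟩
    t * onesPosSumInBlock + triangle t * (d * countInBlock true) ∎

power∈B⇒exponent≡1 : ∀ m n .{{_ : NonZero ((m + 1) * n)}} (w : Word ((m + 1) * n)) → InB m n w →
                     ∀ {d t} → Period (extend w) d → (m + 1) * n ≡ t * d → t ≡ 1
power∈B⇒exponent≡1 m n w _ {t = zero} _ k≡0 = contradiction k≡0 (≢-nonZero⁻¹ ((m + 1) * n))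
power∈B⇒exponent≡1 m n w (zeros , ones , _ , n∣Σ+1) {d} {t@(suc _)} per k≡t*d = ∣1⇒≡1 t∣1
  where
  open ≡-Reasoning
  open PowerOfBlock w {t = t} per k≡t*d

  z o : ℕ
  z = countInBlock false
  o = countInBlock true

  n≡t*z : n ≡ t * z
  n≡t*z = trans (sym zeros) (count-power false)

  d≡[m+1]*z : d ≡ (m + 1) * z
  d≡[m+1]*z = *-cancelˡ-≡ d ((m + 1) * z) t (begin
    t * d              ≡⟨ k≡t*d ⟨
    (m + 1) * n        ≡⟨ cong ((m + 1) *_) n≡t*z ⟩
    (m + 1) * (t * z)  ≡⟨ m*[n*o]≡n*[m*o] (m + 1) t z ⟩
    t * ((m + 1) * z)  ∎)

  o≡m*z : o ≡ m * z
  o≡m*z = *-cancelˡ-≡ o (m * z) t (begin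
    t * o        ≡⟨ count-power true ⟨
    count true w ≡⟨ ones ⟩
    m * n        ≡⟨ cong (m *_) n≡t*z ⟩
    m * (t * z)  ≡⟨ m*[n*o]≡n*[m*o] m t z ⟩
    t * (m * z)  ∎)

  t∣triangle[t]*[d*o] : t ∣ triangle t * (d * o)
  t∣triangle[t]*[d*o] = subst (t ∣_) (begin
    triangle t * (m * suc m) * (z * z)    ≡⟨ regroup (triangle t) m z ⟩
    triangle t * ((m + 1) * z * (m * z))  ≡⟨ cong₂ (λ x y → triangle t * (x * y)) d≡[m+1]*z o≡m*z ⟨
    triangle t * (d * o)                  ∎) (∣m⇒∣m*n (z * z) (n∣triangle[n]*[a*[1+a]] t m))
    where
    regroup : ∀ T m z → T * (m * suc m) * (z * z) ≡ T * ((m + 1) * z * (m * z))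
    regroup = solve-∀

  t∣onesPosSum : t ∣ onesPosSum w
  t∣onesPosSum = subst (t ∣_) (sym onesPosSum-power) (∣m∣n⇒∣m+n (m∣m*n _) t∣triangle[t]*[d*o])

  t∣1 : t ∣ 1
  t∣1 = ∣m+n∣m⇒∣n (∣-trans (divides z (trans n≡t*z (*-comm t z))) n∣Σ+1) t∣onesPosSum

lemma2p2 : (m n : ℕ) → 1 ≤ m → 1 ≤ n → .{{_ : NonZero ((m + 1) * n)}} → (w : Word ((m + 1) * n)) → InB m n w → (j : ℕ) → 1 ≤ j → j < (m + 1) * n → ¬ (rotate j w ≋ w)
lemma2p2 m n _ _ w w∈B j@(suc _) _ j<k fixed = <⇒≱ j<k k≤j
  where
  k = (m + 1) * n
  d = gcd j k

  per : Period (extend w) d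
  per = period-gcd (rotate-fixed⇒period j fixed) (extend-period w)

  k≤j : k ≤ j
  k≤j with divides t k≡t*d ← gcd[m,n]∣n j k with refl ← power∈B⇒exponent≡1 m n w w∈B {t = t} per k≡t*d =
    ≤-trans (≤-reflexive (trans k≡t*d (*-identityˡ d))) (∣⇒≤ (gcd[m,n]∣m j k))
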